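{- Let $G$ be a finite simple graph with order $n(G)$, size $m(G)$ and maximum degree $\Delta(G) \ge 3$. Then \[ c_{\mathrm{ind}}(G)\ge \frac{m(G)-n(G)+1}{(\Delta(G)-2)(\Delta(G)-1)}. \]
   Context: For a graph $G$, $n(G)=|V(G)|$, $m(G)=|E(G)|$, $\Delta(G)$ is the maximum degree, and $c_{\mathrm{ind}}(G)$ (the induced cycle number) denotes the maximum number of vertices of an induced $2$-regular subgraph of $G$, i.e. the maximum cardinality of a vertex set $S \subseteq V(G)$ such that the induced subgraph $G[S]$ is $2$-regular (the empty set is allowed, so $c_{\mathrm{ind}}(G)\ge 0$). -}

module Defs where

open import Data.Nat using (ℕ; zero; suc; _+_; _*_; _∸_; _⊔_; _≤_)
open import Data.Bool using (Bool; true; false; if_then_else_; _∧_)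
open import Data.Fin using (Fin; _<_)
open import Data.List using (List; []; _∷_; map; foldr; filter; length; allFin; concatMap)
open import Data.Nat.ListAction using (sum)
open import Data.Vec.Functional using (Vector)
open import Relation.Binary.PropositionalEquality using (_≡_)
open import Relation.Nullary using (¬_)

record Graph (n : ℕ) : Set where
  field
    adj      : Fin n → Fin n → Bool
    symmetric  : ∀ i j → adj i j ≡ adj j i
    irreflexive : ∀ i → adj i i ≡ false

open Graph public

count : {A : Set} → (A → Bool) → List A → ℕ
count p xs = length (filter (λ x → Data.Bool.T? (p x)) xs)
  where import Data.Bool

order : ∀ {n} → Graph n → ℕ
order {n} _ = n

deg : ∀ {n} → Graph n → Fin n → ℕ
deg {n} G v = count (adj G v) (allFin n)

maxDeg : ∀ {n} → Graph n → ℕ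
maxDeg {n} G = foldr _⊔_ 0 (map (deg G) (allFin n))

size : ∀ {n} → Graph n → ℕ
size {n} G = sum (map (λ i → count (λ j → isLt i j ∧ adj G i j) (allFin n)) (allFin n))
  where
  isLt : Fin n → Fin n → Bool
  isLt i j = Data.Nat._<ᵇ_ (Data.Fin.toℕ i) (Data.Fin.toℕ j)
    where import Data.Nat; import Data.Fin

VSet : ℕ → Set
VSet n = Fin n → Bool

allVSets : (n : ℕ) → List (VSet n)
allVSets zero = (λ ()) ∷ []
allVSets (suc n) = concatMap (λ S → ext false S ∷ ext true S ∷ []) (allVSets n)
  where
  ext : Bool → VSet n → VSet (suc n)
  ext b S Fin.zero = b
  ext b S (Fin.suc i) = S i
    where import Data.Fin as Fin

card : ∀ {n} → VSet n → ℕ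
card {n} S = count S (allFin n)

degIn : ∀ {n} → Graph n → VSet n → Fin n → ℕ
degIn {n} G S v = count (λ u → S u ∧ adj G v u) (allFin n)

-- G[S] is 2-regular: every vertex v ∈ S has exactly 2 neighbours in S
-- (the empty set qualifies vacuously)
allᵇ : {A : Set} → (A → Bool) → List A → Bool
allᵇ p xs = foldr (λ x b → p x ∧ b) true xs

is2Regᵇ : ∀ {n} → Graph n → VSet n → Bool
is2Regᵇ {n} G S =
  allᵇ (λ v → if S v then Data.Nat._≡ᵇ_ (degIn G S v) 2 else true) (allFin n)
  where import Data.Nat

cind : ∀ {n} → Graph n → ℕ
cind {n} G = foldr _⊔_ 0 (map card (filter (λ S → Data.Bool.T? (is2Regᵇ G S)) (allVSets n)))
  where import Data.Bool

module Submission where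

-- Write m(S) for the number of edges of G[S] and d = (Δ − 2)(Δ − 1). By induction on |S|,
-- every nonempty S contains an induced 2-regular U with m(S) + 1 ≤ |U| d + |S|.
-- If m(S) < |S| take U = ∅. Otherwise G[S] has a nonempty induced 2-regular C: delete
-- vertices of degree at most m(S) − |S| + 1 while there are any (this never decreases
-- m(S) − |S|); once there are none, double counting forces every degree to be exactly 2.
-- Split S into C, the set N of other vertices of S with a neighbour in C, and the rest R.
-- At most (Δ − 2)|C| edges leave C, so |N| ≤ (Δ − 2)|C|, and at most Δ|N| edges meet N;
-- together these cost at most |C| d + |N|. No edge joins C to R, so C together with the
-- set found in R by induction is again induced 2-regular, and the bounds add up.

open import Defs
open import Data.Nat.Base using (ℕ; zero; suc; _+_; _*_; _∸_; _≤_; _<_; _⊔_; _<ᵇ_; _≡ᵇ_; z≤n; s≤s)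
open import Data.Nat.Properties hiding (_≟_)
open import Data.Nat.Tactic.RingSolver using (solve-∀)
open import Data.Nat.ListAction using (sum)
open import Algebra.Properties.Semiring.Sum +-*-semiring
  using (∑-distrib-+; ∑-comm; *-distribˡ-sum; *-distribʳ-sum; sum-cong-≗; sum-replicate-zero)
  renaming (sum to ∑)
open import Data.Bool using (Bool; true; false; _∧_; _∨_; not; if_then_else_; T; T?)
import Data.Bool.Properties as Bool
open import Data.Unit using (tt)
open import Data.Fin using (Fin; zero; suc; toℕ)
open import Data.Fin.Properties using (_≟_; any?)
open import Data.List using ([]; _∷_; map; foldr; tabulate; allFin)
open import Data.List.Membership.Propositional using (_∈_; lose)
open import Data.List.Membership.Propositional.Properties using (∈-map⁺; ∈-filter⁺; ∈-concatMap⁺; ∈-allFin)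
open import Data.List.Relation.Unary.Any using (here; there)
open import Data.Product using (∃-syntax; _×_; _,_)
open import Function using (_∘_; id)
open import Relation.Nullary using (¬_; Dec; yes; no; contradiction)
open import Relation.Nullary.Decidable using (does; _×-dec_)
open import Relation.Binary.PropositionalEquality

∑-mono-≤ : ∀ {n} {f g : Fin n → ℕ} → (∀ i → f i ≤ g i) → ∑ f ≤ ∑ g
∑-mono-≤ {zero}  _   = z≤n
∑-mono-≤ {suc n} f≤g = +-mono-≤ (f≤g zero) (∑-mono-≤ (f≤g ∘ suc))

≤-∑ : ∀ {n} (f : Fin n → ℕ) i → f i ≤ ∑ f
≤-∑ f zero    = m≤m+n (f zero) _
≤-∑ f (suc i) = ≤-trans (≤-∑ (f ∘ suc) i) (m≤n+m _ (f zero))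

∑-ones : ∀ n → ∑ {n} (λ _ → 1) ≡ n
∑-ones zero    = refl
∑-ones (suc n) = cong suc (∑-ones n)

∑≡0⇒≡0 : ∀ {n} (f : Fin n → ℕ) → ∑ f ≡ 0 → ∀ i → f i ≡ 0
∑≡0⇒≡0 f ∑f≡0 i = n≤0⇒n≡0 (subst (f i ≤_) ∑f≡0 (≤-∑ f i))

∑-mono-≤-tight : ∀ {n} {f g : Fin n → ℕ} → (∀ i → f i ≤ g i) → ∑ g ≤ ∑ f → ∀ i → f i ≡ g i
∑-mono-≤-tight {n} {f} {g} f≤g ∑g≤∑f i =
  ≤-antisym (f≤g i) (m∸n≡0⇒m≤n (∑≡0⇒≡0 (λ j → g j ∸ f j) gap i))
  where
  open ≤-Reasoning
  gap : ∑ (λ j → g j ∸ f j) ≡ 0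
  gap = n≤0⇒n≡0 (+-cancelˡ-≤ (∑ f) _ _ (begin
    ∑ f + ∑ (λ j → g j ∸ f j)    ≡⟨ ∑-distrib-+ f _ ⟨
    ∑ (λ j → f j + (g j ∸ f j))  ≡⟨ sum-cong-≗ (λ j → m+[n∸m]≡n (f≤g j)) ⟩
    ∑ g                          ≤⟨ ∑g≤∑f ⟩
    ∑ f                          ≡⟨ +-identityʳ (∑ f) ⟨
    ∑ f + 0                      ∎))

m≡ᵇ0⇒m≡0 : ∀ m → (m ≡ᵇ 0) ≡ true → m ≡ 0
m≡ᵇ0⇒m≡0 zero _ = refl

𝟙 : Bool → ℕ
𝟙 true  = 1
𝟙 false = 0

𝟙≤1 : ∀ b → 𝟙 b ≤ 1
𝟙≤1 true  = ≤-refl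
𝟙≤1 false = z≤n

𝟙-∧ : ∀ a b → 𝟙 (a ∧ b) ≡ 𝟙 a * 𝟙 b
𝟙-∧ true  b = sym (+-identityʳ (𝟙 b))
𝟙-∧ false b = refl

δ : ∀ {n} → Fin n → Fin n → ℕ
δ v u = 𝟙 (does (u ≟ v))

∑-δ : ∀ {n} v (f : Fin n → ℕ) → ∑ (λ u → δ v u * f u) ≡ f v
∑-δ {suc n} zero    f = begin
  f zero + 0 + ∑ {n} (λ _ → 0)  ≡⟨ cong (f zero + 0 +_) (sum-replicate-zero n) ⟩
  f zero + 0 + 0                ≡⟨ cong (_+ 0) (+-identityʳ (f zero)) ⟩
  f zero + 0                    ≡⟨ +-identityʳ (f zero) ⟩
  f zero                        ∎
  where open ≡-Reasoning
∑-δ {suc n} (suc v) f = ∑-δ v (λ u → f (suc u))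

module _ {n : ℕ} where

  χ : VSet n → Fin n → ℕ
  χ S u = 𝟙 (S u)

  ∣_∣ : VSet n → ℕ
  ∣ S ∣ = ∑ (χ S)

  ∅ : VSet n
  ∅ _ = false

  ∣∅∣ : ∣ ∅ ∣ ≡ 0
  ∣∅∣ = sum-replicate-zero n

  _⊆_ : VSet n → VSet n → Set
  T ⊆ S = ∀ v → T v ≡ true → S v ≡ true

  _∪_ : VSet n → VSet n → VSet n
  (S ∪ T) v = S v ∨ T v

  _─_ : VSet n → Fin n → VSet n
  (S ─ v) u = S u ∧ not (does (u ≟ v))

  infixl 6 _⊕_
  _⊕_ : (Fin n → ℕ) → (Fin n → ℕ) → Fin n → ℕ
  (X ⊕ Y) u = X u + Y u

  χ-∪ : ∀ S T → (∀ v → S v ≡ true → T v ≡ false) → ∀ v → χ (S ∪ T) v ≡ (χ S ⊕ χ T) v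
  χ-∪ S T disjoint v with S v in Sv
  ... | true  rewrite disjoint v Sv = refl
  ... | false = refl

  χ-─ : ∀ S v → S v ≡ true → ∀ u → χ S u ≡ (χ (S ─ v) ⊕ δ v) u
  χ-─ S v Sv u with u ≟ v
  ... | yes refl rewrite Sv = refl
  ... | no _ with S u
  ...   | true  = refl
  ...   | false = refl

  χ-mono : ∀ {T S} → T ⊆ S → ∀ u → χ T u ≤ χ S u
  χ-mono {T} T⊆S u with T u in Tu
  ... | true  rewrite T⊆S u Tu = ≤-refl
  ... | false = z≤n

  ─-⊆ : ∀ S v → (S ─ v) ⊆ S
  ─-⊆ S v u h with S u
  ... | true  = refl
  ... | false = h

  ∣─∣ : ∀ S v → S v ≡ true → ∣ S ∣ ≡ ∣ S ─ v ∣ + 1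
  ∣─∣ S v Sv = begin
    ∑ (χ S)                          ≡⟨ sum-cong-≗ (χ-─ S v Sv) ⟩
    ∑ (χ (S ─ v) ⊕ δ v)              ≡⟨ ∑-distrib-+ (χ (S ─ v)) (δ v) ⟩
    ∣ S ─ v ∣ + ∑ (δ v)              ≡⟨ cong (∣ S ─ v ∣ +_) (sum-cong-≗ (λ u → *-identityʳ (δ v u))) ⟨
    ∣ S ─ v ∣ + ∑ (λ u → δ v u * 1)  ≡⟨ cong (∣ S ─ v ∣ +_) (∑-δ v (λ _ → 1)) ⟩
    ∣ S ─ v ∣ + 1                    ∎
    where open ≡-Reasoning

  χ-*-mono : ∀ S v {x y} → (S v ≡ true → x ≤ y) → χ S v * x ≤ χ S v * y
  χ-*-mono S v x≤y with S v
  ... | true  = +-monoˡ-≤ 0 (x≤y refl)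
  ... | false = z≤n

  χ-*-cong : ∀ S v {x y} → (S v ≡ true → x ≡ y) → χ S v * x ≡ χ S v * y
  χ-*-cong S v x≡y with S v
  ... | true  = cong (_+ 0) (x≡y refl)
  ... | false = refl

  χ-*-cancel : ∀ S v {x y} → S v ≡ true → χ S v * x ≡ χ S v * y → x ≡ y
  χ-*-cancel S v {x} {y} Sv eq rewrite Sv = +-cancelʳ-≡ 0 x y eq

-- Vertices carry ℕ-weights so that arcs is bilinear: splitting a vertex set splits edge counts.
module Arcs {n : ℕ} (G : Graph n) where

  A : Fin n → Fin n → ℕ
  A v u = 𝟙 (adj G v u)

  degW : (Fin n → ℕ) → Fin n → ℕ
  degW X v = ∑ (λ u → X u * A v u)

  arcs : (Fin n → ℕ) → (Fin n → ℕ) → ℕ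
  arcs X Y = ∑ (λ v → X v * degW Y v)

  degSum : VSet n → ℕ
  degSum S = arcs (χ S) (χ S)

  TwoRegular : VSet n → Set
  TwoRegular T = ∀ v → T v ≡ true → degW (χ T) v ≡ 2

  A-sym : ∀ v u → A v u ≡ A u v
  A-sym v u = cong 𝟙 (symmetric G v u)

  degW-cong : ∀ {X Y} → (∀ u → X u ≡ Y u) → ∀ v → degW X v ≡ degW Y v
  degW-cong X≗Y v = sum-cong-≗ (λ u → cong (_* A v u) (X≗Y u))

  degW-mono : ∀ {X Y} → (∀ u → X u ≤ Y u) → ∀ v → degW X v ≤ degW Y v
  degW-mono X≤Y v = ∑-mono-≤ (λ u → *-monoˡ-≤ (A v u) (X≤Y u))

  degW-⊕ : ∀ X Y v → degW (X ⊕ Y) v ≡ degW X v + degW Y v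
  degW-⊕ X Y v = trans (sum-cong-≗ (λ u → *-distribʳ-+ (A v u) (X u) (Y u))) (∑-distrib-+ {n} _ _)

  degW-δ : ∀ w v → degW (δ w) v ≡ A v w
  degW-δ w v = ∑-δ w (A v)

  degW-δ-self : ∀ v → degW (δ v) v ≡ 0
  degW-δ-self v = trans (degW-δ v v) (cong 𝟙 (irreflexive G v))

  degW≤∑ : ∀ X v → degW X v ≤ ∑ X
  degW≤∑ X v = ∑-mono-≤ (λ u → ≤-trans (*-monoʳ-≤ (X u) (𝟙≤1 (adj G v u))) (≤-reflexive (*-identityʳ (X u))))

  arcs-cong : ∀ {X X′ Y Y′} → (∀ u → X u ≡ X′ u) → (∀ u → Y u ≡ Y′ u) → arcs X Y ≡ arcs X′ Y′
  arcs-cong X≗X′ Y≗Y′ = sum-cong-≗ (λ v → cong₂ _*_ (X≗X′ v) (degW-cong Y≗Y′ v))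

  arcs-monoʳ : ∀ X {Y Y′} → (∀ u → Y u ≤ Y′ u) → arcs X Y ≤ arcs X Y′
  arcs-monoʳ X Y≤Y′ = ∑-mono-≤ (λ v → *-monoʳ-≤ (X v) (degW-mono Y≤Y′ v))

  arcs-⊕ˡ : ∀ X X′ Y → arcs (X ⊕ X′) Y ≡ arcs X Y + arcs X′ Y
  arcs-⊕ˡ X X′ Y = trans (sum-cong-≗ (λ v → *-distribʳ-+ (degW Y v) (X v) (X′ v))) (∑-distrib-+ {n} _ _)

  arcs-⊕ʳ : ∀ X Y Y′ → arcs X (Y ⊕ Y′) ≡ arcs X Y + arcs X Y′
  arcs-⊕ʳ X Y Y′ = trans (sum-cong-≗ λ v → trans (cong (X v *_) (degW-⊕ Y Y′ v)) (*-distribˡ-+ (X v) _ _))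
                         (∑-distrib-+ {n} _ _)

  arcs-δˡ : ∀ v Y → arcs (δ v) Y ≡ degW Y v
  arcs-δˡ v Y = ∑-δ v (degW Y)

  arcs-zeroˡ : ∀ {X} Y → (∀ u → X u ≡ 0) → arcs X Y ≡ 0
  arcs-zeroˡ Y X≗0 = trans (sum-cong-≗ (λ v → cong (_* degW Y v) (X≗0 v))) (sum-replicate-zero n)

  arcs-sym : ∀ X Y → arcs X Y ≡ arcs Y X
  arcs-sym X Y = begin
    ∑ (λ v → X v * ∑ (λ u → Y u * A v u))    ≡⟨ sum-cong-≗ (λ v → *-distribˡ-sum {n} (X v) _) ⟩
    ∑ (λ v → ∑ (λ u → X v * (Y u * A v u)))  ≡⟨ ∑-comm {n} {n} _ ⟩
    ∑ (λ u → ∑ (λ v → X v * (Y u * A v u)))  ≡⟨ sum-cong-≗ (λ u → sum-cong-≗ (λ v → swap u v)) ⟩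
    ∑ (λ u → ∑ (λ v → Y u * (X v * A u v)))  ≡⟨ sum-cong-≗ (λ u → *-distribˡ-sum {n} (Y u) _) ⟨
    ∑ (λ u → Y u * ∑ (λ v → X v * A u v))    ∎
    where
    open ≡-Reasoning
    exchange : ∀ x y a → x * (y * a) ≡ y * (x * a)
    exchange = solve-∀
    swap : ∀ u v → X v * (Y u * A v u) ≡ Y u * (X v * A u v)
    swap u v = trans (exchange (X v) (Y u) (A v u)) (cong (λ a → Y u * (X v * a)) (A-sym v u))

  arcs≡0⇒degW≡0 : ∀ T Y → arcs (χ T) Y ≡ 0 → ∀ v → T v ≡ true → degW Y v ≡ 0
  arcs≡0⇒degW≡0 T Y arcs≡0 v Tv = χ-*-cancel T v Tv (trans (∑≡0⇒≡0 _ arcs≡0 v) (sym (*-zeroʳ (χ T v))))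

  degW-─ : ∀ S v → S v ≡ true → degW (χ S) v ≡ degW (χ (S ─ v)) v
  degW-─ S v Sv = begin
    degW (χ S) v                          ≡⟨ degW-cong (χ-─ S v Sv) v ⟩
    degW (χ (S ─ v) ⊕ δ v) v              ≡⟨ degW-⊕ (χ (S ─ v)) (δ v) v ⟩
    degW (χ (S ─ v)) v + degW (δ v) v     ≡⟨ cong (degW (χ (S ─ v)) v +_) (degW-δ-self v) ⟩
    degW (χ (S ─ v)) v + 0                ≡⟨ +-identityʳ _ ⟩
    degW (χ (S ─ v)) v                    ∎
    where open ≡-Reasoning

  degW<∣∣ : ∀ S v → S v ≡ true → degW (χ S) v + 1 ≤ ∣ S ∣
  degW<∣∣ S v Sv = begin
    degW (χ S) v + 1         ≡⟨ cong (_+ 1) (degW-─ S v Sv) ⟩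
    degW (χ (S ─ v)) v + 1   ≤⟨ +-monoˡ-≤ 1 (degW≤∑ (χ (S ─ v)) v) ⟩
    ∣ S ─ v ∣ + 1            ≡⟨ ∣─∣ S v Sv ⟨
    ∣ S ∣                    ∎
    where open ≤-Reasoning

  degSum-─ : ∀ S v → S v ≡ true → degSum S ≡ degSum (S ─ v) + 2 * degW (χ S) v
  degSum-─ S v Sv = begin
    arcs (χ S) (χ S)                                      ≡⟨ arcs-cong (χ-─ S v Sv) (χ-─ S v Sv) ⟩
    arcs (X ⊕ δ v) (X ⊕ δ v)                              ≡⟨ arcs-⊕ˡ X (δ v) (X ⊕ δ v) ⟩
    arcs X (X ⊕ δ v) + arcs (δ v) (X ⊕ δ v)               ≡⟨ cong₂ _+_ (arcs-⊕ʳ X X (δ v)) (arcs-δˡ v (X ⊕ δ v)) ⟩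
    arcs X X + arcs X (δ v) + degW (X ⊕ δ v) v
      ≡⟨ cong₂ (λ a b → arcs X X + a + b) (trans (arcs-sym X (δ v)) (arcs-δˡ v X)) (degW-⊕ X (δ v) v) ⟩
    arcs X X + degW X v + (degW X v + degW (δ v) v)
      ≡⟨ cong (λ a → arcs X X + degW X v + (degW X v + a)) (degW-δ-self v) ⟩
    arcs X X + degW X v + (degW X v + 0)                  ≡⟨ double (arcs X X) (degW X v) ⟩
    arcs X X + 2 * degW X v                               ≡⟨ cong (λ a → arcs X X + 2 * a) (degW-─ S v Sv) ⟨
    degSum (S ─ v) + 2 * degW (χ S) v                     ∎
    where
    open ≡-Reasoning
    X = χ (S ─ v)
    double : ∀ a b → a + b + (b + 0) ≡ a + 2 * b
    double = solve-∀

  degSum≤ : ∀ S → degSum S ≤ ∣ S ∣ * (∣ S ∣ ∸ 1)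
  degSum≤ S = begin
    ∑ (λ v → χ S v * degW (χ S) v)  ≤⟨ ∑-mono-≤ (λ v → χ-*-mono S v (λ Sv → m+n≤o⇒m≤o∸n _ (degW<∣∣ S v Sv))) ⟩
    ∑ (λ v → χ S v * (∣ S ∣ ∸ 1))   ≡⟨ *-distribʳ-sum {n} (∣ S ∣ ∸ 1) (χ S) ⟨
    ∣ S ∣ * (∣ S ∣ ∸ 1)            ∎
    where open ≤-Reasoning

  degSum-TwoRegular : ∀ T → TwoRegular T → degSum T ≡ 2 * ∣ T ∣
  degSum-TwoRegular T twoRegular = begin
    ∑ (λ v → χ T v * degW (χ T) v)  ≡⟨ sum-cong-≗ (λ v → χ-*-cong T v (twoRegular v)) ⟩
    ∑ (λ v → χ T v * 2)             ≡⟨ *-distribʳ-sum {n} 2 (χ T) ⟨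
    ∣ T ∣ * 2                        ≡⟨ *-comm ∣ T ∣ 2 ⟩
    2 * ∣ T ∣                        ∎
    where open ≡-Reasoning

  TwoRegular-∪ : ∀ T T′ → TwoRegular T → TwoRegular T′ → arcs (χ T) (χ T′) ≡ 0 → TwoRegular (T ∪ T′)
  TwoRegular-∪ T T′ reg reg′ noArcs v T∪T′v = begin
    degW (χ (T ∪ T′)) v           ≡⟨ degW-cong (χ-∪ T T′ disjoint) v ⟩
    degW (χ T ⊕ χ T′) v           ≡⟨ degW-⊕ (χ T) (χ T′) v ⟩
    degW (χ T) v + degW (χ T′) v  ≡⟨ sum≡2 (T v) refl ⟩
    2                             ∎
    where
    open ≡-Reasoning
    T→T′-free : ∀ v → T v ≡ true → degW (χ T′) v ≡ 0
    T→T′-free = arcs≡0⇒degW≡0 T (χ T′) noArcs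
    T′→T-free : ∀ v → T′ v ≡ true → degW (χ T) v ≡ 0
    T′→T-free = arcs≡0⇒degW≡0 T′ (χ T) (trans (arcs-sym (χ T′) (χ T)) noArcs)
    disjoint : ∀ v → T v ≡ true → T′ v ≡ false
    disjoint v Tv with T′ v in T′v
    ... | true  = contradiction (trans (sym (reg′ v T′v)) (T→T′-free v Tv)) λ ()
    ... | false = refl
    sum≡2 : ∀ b → T v ≡ b → degW (χ T) v + degW (χ T′) v ≡ 2
    sum≡2 true  Tv = cong₂ _+_ (reg v Tv) (T→T′-free v Tv)
    sum≡2 false Tv = cong₂ _+_ (T′→T-free v T′v) (reg′ v T′v)
      where T′v = subst (λ b → b ∨ T′ v ≡ true) Tv T∪T′v

-- Dense induced subgraphs contain induced cycles

order≥3 : ∀ s e → 1 ≤ s → e ≤ s * (s ∸ 1) → 2 * s ≤ e + 1 → 3 ≤ s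
order≥3 1 0       _ _   (s≤s ())
order≥3 1 (suc e) _ ()  _
order≥3 2 e       _ e≤2 4≤e+1 = contradiction (≤-trans (+-cancelʳ-≤ 1 3 e 4≤e+1) e≤2) λ { (s≤s (s≤s ())) }
order≥3 (suc (suc (suc s))) _ _ _ _ = s≤s (s≤s (s≤s z≤n))

excess-─ : ∀ c e d → 2 * d + 2 * (c + 1) ≤ (e + 2 * d) + 3 → 2 * c ≤ e + 1
excess-─ c e d h = +-cancelʳ-≤ 2 _ _ (+-cancelˡ-≤ (2 * d) _ _ (subst₂ _≤_ (lhs c d) (rhs e d) h))
  where
  lhs : ∀ c d → 2 * d + 2 * (c + 1) ≡ 2 * d + (2 * c + 2)
  lhs = solve-∀
  rhs : ∀ e d → (e + 2 * d) + 3 ≡ 2 * d + ((e + 1) + 2)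
  rhs = solve-∀

e≤2s : ∀ s e → 3 ≤ s → s * (e + 4) ≤ 2 * e + s * (2 * s) → e ≤ 2 * s
e≤2s (suc (suc (suc r))) e (s≤s (s≤s (s≤s _))) h =
  *-cancelˡ-≤ (suc r) (+-cancelˡ-≤ (2 * e + 8 + 4 * suc r) _ _ (subst₂ _≤_ (lhs r e) (rhs r e) h))
  where
  lhs : ∀ r e → (3 + r) * (e + 4) ≡ (2 * e + 8 + 4 * suc r) + suc r * e
  lhs = solve-∀
  rhs : ∀ r e → 2 * e + (3 + r) * (2 * (3 + r)) ≡ (2 * e + 8 + 4 * suc r) + suc r * (2 * (3 + r))
  rhs = solve-∀

degree≥2 : ∀ s e d → 2 * s ≤ e + 1 → e + 4 ≤ 2 * d + 2 * s → 2 ≤ d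
degree≥2 s e d 2s≤e+1 e+4≤ = half d (+-cancelˡ-≤ (2 * s) _ _ (begin
  2 * s + 3       ≤⟨ +-monoˡ-≤ 3 2s≤e+1 ⟩
  e + 1 + 3       ≡⟨ +-assoc e 1 3 ⟩
  e + 4           ≤⟨ e+4≤ ⟩
  2 * d + 2 * s   ≡⟨ +-comm (2 * d) (2 * s) ⟩
  2 * s + 2 * d   ∎))
  where
  open ≤-Reasoning
  half : ∀ d → 3 ≤ 2 * d → 2 ≤ d
  half (suc (suc d)) _ = s≤s (s≤s z≤n)
  half 1 (s≤s (s≤s ()))

module InducedCycle {n : ℕ} (G : Graph n) where
  open Arcs G

  -- m(G[S]) ≥ |S|, written with degSum S = 2 m(G[S]).
  ManyEdges : VSet n → Set
  ManyEdges S = 2 * ∣ S ∣ ≤ degSum S + 1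

  -- Deleting such a vertex keeps m(G[S]) − |S| from decreasing.
  Deletable : VSet n → Fin n → Set
  Deletable S v = S v ≡ true × 2 * degW (χ S) v + 2 * ∣ S ∣ ≤ degSum S + 3

  deletable? : ∀ S → Dec (∃[ v ] Deletable S v)
  deletable? S = any? (λ v → (S v Bool.≟ true) ×-dec (2 * degW (χ S) v + 2 * ∣ S ∣ ≤? degSum S + 3))

  ManyEdges-─ : ∀ S v → Deletable S v → ManyEdges (S ─ v)
  ManyEdges-─ S v (Sv , low) = excess-─ ∣ S ─ v ∣ (degSum (S ─ v)) (degW (χ S) v)
    (subst₂ (λ s e → 2 * degW (χ S) v + 2 * s ≤ e + 3) (∣─∣ S v Sv) (degSum-─ S v Sv) low)

  noneDeletable⇒TwoRegular : ∀ S → 3 ≤ ∣ S ∣ → ManyEdges S → ¬ (∃[ v ] Deletable S v) → TwoRegular S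
  noneDeletable⇒TwoRegular S 3≤s manyEdges noneDeletable v Sv =
    sym (χ-*-cancel S v Sv (∑-mono-≤-tight degree≥2ₛ degSum≤2s v))
    where
    s = ∣ S ∣
    e = degSum S
    high : ∀ v → S v ≡ true → e + 4 ≤ 2 * degW (χ S) v + 2 * s
    high v Sv with 2 * degW (χ S) v + 2 * s ≤? e + 3
    ... | yes low = contradiction (v , Sv , low) noneDeletable
    ... | no ¬low = subst (_≤ 2 * degW (χ S) v + 2 * s) (sym (+-suc e 3)) (≰⇒> ¬low)
    degree≥2ₛ : ∀ v → χ S v * 2 ≤ χ S v * degW (χ S) v
    degree≥2ₛ v = χ-*-mono S v (λ Sv → degree≥2 s e (degW (χ S) v) manyEdges (high v Sv))
    doubleCount : s * (e + 4) ≤ 2 * e + s * (2 * s)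
    doubleCount = begin
      s * (e + 4)
        ≡⟨ *-distribʳ-sum {n} (e + 4) (χ S) ⟩
      ∑ (λ v → χ S v * (e + 4))
        ≤⟨ ∑-mono-≤ (λ v → χ-*-mono S v (high v)) ⟩
      ∑ (λ v → χ S v * (2 * degW (χ S) v + 2 * s))
        ≡⟨ sum-cong-≗ (λ v → distrib (χ S v) (degW (χ S) v) s) ⟩
      ∑ (λ v → 2 * (χ S v * degW (χ S) v) + χ S v * (2 * s))
        ≡⟨ ∑-distrib-+ {n} _ _ ⟩
      ∑ (λ v → 2 * (χ S v * degW (χ S) v)) + ∑ (λ v → χ S v * (2 * s))
        ≡⟨ cong₂ _+_ (*-distribˡ-sum {n} 2 _) (*-distribʳ-sum {n} (2 * s) (χ S)) ⟨
      2 * e + s * (2 * s)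
        ∎
      where
      open ≤-Reasoning
      distrib : ∀ x d s → x * (2 * d + 2 * s) ≡ 2 * (x * d) + x * (2 * s)
      distrib = solve-∀
    degSum≤2s : ∑ (λ v → χ S v * degW (χ S) v) ≤ ∑ (λ v → χ S v * 2)
    degSum≤2s = ≤-trans (e≤2s s e 3≤s doubleCount)
                        (≤-reflexive (trans (*-comm 2 s) (*-distribʳ-sum {n} 2 (χ S))))

  ManyEdges⇒TwoRegular⊆ : ∀ S → 1 ≤ ∣ S ∣ → ManyEdges S → ∃[ T ] T ⊆ S × TwoRegular T × 1 ≤ ∣ T ∣
  ManyEdges⇒TwoRegular⊆ S = go ∣ S ∣ S ≤-refl
    where
    go : ∀ k S → ∣ S ∣ ≤ k → 1 ≤ ∣ S ∣ → ManyEdges S → ∃[ T ] T ⊆ S × TwoRegular T × 1 ≤ ∣ T ∣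
    go zero S s≤0 1≤s _ = contradiction (≤-trans 1≤s s≤0) λ ()
    go (suc k) S s≤k+1 1≤s manyEdges = step (deletable? S)
      where
      3≤s : 3 ≤ ∣ S ∣
      3≤s = order≥3 ∣ S ∣ (degSum S) 1≤s (degSum≤ S) manyEdges
      step : Dec (∃[ v ] Deletable S v) → ∃[ T ] T ⊆ S × TwoRegular T × 1 ≤ ∣ T ∣
      step (no noneDeletable) = S , (λ _ Sv → Sv) , noneDeletable⇒TwoRegular S 3≤s manyEdges noneDeletable , 1≤s
      step (yes (v , deletable@(Sv , _))) with go k (S ─ v) s′≤k 1≤s′ (ManyEdges-─ S v deletable)
        where
        s≡1+s′ : ∣ S ∣ ≡ suc ∣ S ─ v ∣
        s≡1+s′ = trans (∣─∣ S v Sv) (+-comm _ 1)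
        s′≤k : ∣ S ─ v ∣ ≤ k
        s′≤k = ≤-pred (subst (_≤ suc k) s≡1+s′ s≤k+1)
        1≤s′ : 1 ≤ ∣ S ─ v ∣
        1≤s′ = ≤-trans (s≤s z≤n) (≤-pred (subst (3 ≤_) s≡1+s′ 3≤s))
      ... | T , T⊆S─v , twoRegular , 1≤t = T , (λ u Tu → ─-⊆ S v u (T⊆S─v u Tu)) , twoRegular , 1≤t

-- The inductive bound

module Split {n : ℕ} (G : Graph n) (S T : VSet n) (T⊆S : T ⊆ S) where
  open Arcs G

  N R : VSet n
  N v = S v ∧ not (T v) ∧ not (degW (χ T) v ≡ᵇ 0)
  R v = S v ∧ not (T v) ∧ (degW (χ T) v ≡ᵇ 0)

  χ-split : ∀ v → χ S v ≡ (χ T ⊕ χ N ⊕ χ R) v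
  χ-split v with T v in Tv
  ... | true rewrite T⊆S v Tv = refl
  ... | false with S v
  ...   | false = refl
  ...   | true with degW (χ T) v ≡ᵇ 0
  ...     | true  = refl
  ...     | false = refl

  R⊆S : R ⊆ S
  R⊆S v Rv with S v
  ... | true  = refl
  ... | false = Rv

  R⇒∉T : ∀ v → R v ≡ true → T v ≡ false
  R⇒∉T v Rv with S v | T v
  ... | true  | false = refl
  ... | true  | true  = contradiction Rv λ ()
  ... | false | _     = contradiction Rv λ ()

  R⇒noNeighbourInT : ∀ v → R v ≡ true → degW (χ T) v ≡ 0
  R⇒noNeighbourInT v Rv with S v | T v | degW (χ T) v ≡ᵇ 0 in isZero
  ... | true  | false | true  = m≡ᵇ0⇒m≡0 _ isZero
  ... | true  | false | false = contradiction Rv λ ()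
  ... | true  | true  | _     = contradiction Rv λ ()
  ... | false | _     | _     = contradiction Rv λ ()

  N⇒neighbourInT : ∀ v → χ N v ≤ χ N v * degW (χ T) v
  N⇒neighbourInT v with S v | T v | degW (χ T) v ≡ᵇ 0 in isZero
  ... | true  | false | false = ≤-trans (m≢0⇒1≤m isZero) (m≤m+n _ 0)
    where
    m≢0⇒1≤m : ∀ {m} → (m ≡ᵇ 0) ≡ false → 1 ≤ m
    m≢0⇒1≤m {suc m} _ = s≤s z≤n
  ... | true  | false | true  = z≤n
  ... | true  | true  | _     = z≤n
  ... | false | _     | _     = z≤n

  ∣S∣-split : ∣ S ∣ ≡ ∣ T ∣ + ∣ N ∣ + ∣ R ∣
  ∣S∣-split = trans (sum-cong-≗ χ-split) (trans (∑-distrib-+ {n} _ _) (cong (_+ ∣ R ∣) (∑-distrib-+ {n} _ _)))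

  arcs-splitˡ : ∀ Y → arcs (χ S) Y ≡ arcs (χ T) Y + arcs (χ N) Y + arcs (χ R) Y
  arcs-splitˡ Y = trans (arcs-cong {Y = Y} χ-split (λ _ → refl))
                        (trans (arcs-⊕ˡ (χ T ⊕ χ N) (χ R) Y) (cong (_+ arcs (χ R) Y) (arcs-⊕ˡ (χ T) (χ N) Y)))

  arcs-splitʳ : ∀ X → arcs X (χ S) ≡ arcs X (χ T) + arcs X (χ N) + arcs X (χ R)
  arcs-splitʳ X = trans (arcs-cong {X} (λ _ → refl) χ-split)
                        (trans (arcs-⊕ʳ X (χ T ⊕ χ N) (χ R)) (cong (_+ arcs X (χ R)) (arcs-⊕ʳ X (χ T) (χ N))))

  arcs-R-T : arcs (χ R) (χ T) ≡ 0
  arcs-R-T = trans (sum-cong-≗ noArc) (sum-replicate-zero n)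
    where
    noArc : ∀ v → χ R v * degW (χ T) v ≡ 0
    noArc v = trans (χ-*-cong R v (R⇒noNeighbourInT v)) (*-zeroʳ (χ R v))

  arcs-T-R : arcs (χ T) (χ R) ≡ 0
  arcs-T-R = trans (arcs-sym (χ T) (χ R)) arcs-R-T

  ∣N∣≤arcs-N-T : ∣ N ∣ ≤ arcs (χ N) (χ T)
  ∣N∣≤arcs-N-T = ∑-mono-≤ N⇒neighbourInT

  degSum-split : degSum S ≡ degSum T + 2 * arcs (χ T) (χ N) + degSum N + 2 * arcs (χ N) (χ R) + degSum R
  degSum-split = begin
    arcs (χ S) (χ S)
      ≡⟨ arcs-splitˡ (χ S) ⟩
    arcs (χ T) (χ S) + arcs (χ N) (χ S) + arcs (χ R) (χ S)
      ≡⟨ cong₂ _+_ (cong₂ _+_ (arcs-splitʳ (χ T)) (arcs-splitʳ (χ N))) (arcs-splitʳ (χ R)) ⟩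
    (TT + TN + TR) + (NT + NN + NR) + (RT + RN + RR)
      ≡⟨ cong₂ (λ a b → (TT + TN + a) + (NT + NN + NR) + (b + RN + RR)) arcs-T-R arcs-R-T ⟩
    (TT + TN + 0) + (NT + NN + NR) + (0 + RN + RR)
      ≡⟨ cong₂ (λ a b → (TT + TN + 0) + (a + NN + NR) + (0 + b + RR)) (arcs-sym (χ N) (χ T)) (arcs-sym (χ R) (χ N)) ⟩
    (TT + TN + 0) + (TN + NN + NR) + (0 + NR + RR)
      ≡⟨ regroup TT TN NN NR RR ⟩
    TT + 2 * TN + NN + 2 * NR + RR
      ∎
    where
    open ≡-Reasoning
    TT = degSum T ; TN = arcs (χ T) (χ N) ; TR = arcs (χ T) (χ R)
    NT = arcs (χ N) (χ T) ; NN = degSum N ; NR = arcs (χ N) (χ R)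
    RT = arcs (χ R) (χ T) ; RN = arcs (χ R) (χ N) ; RR = degSum R
    regroup : ∀ a b c d e → (a + b + 0) + (b + c + d) + (0 + d + e) ≡ a + 2 * b + c + 2 * d + e
    regroup = solve-∀

-- Δ = 3 + e bounds the degrees and d = (Δ − 2)(Δ − 1).
module StepArithmetic (e : ℕ) where

  Δ d : ℕ
  Δ = 3 + e
  d = (1 + e) * (2 + e)

  2≤d : 2 ≤ d
  2≤d = *-mono-≤ {1} {1 + e} {2} {2 + e} (s≤s z≤n) (s≤s (s≤s z≤n))

  leaving≤ : ∀ t x → 2 * t + x ≤ Δ * t → x ≤ (1 + e) * t
  leaving≤ t x h = +-cancelˡ-≤ (2 * t) _ _ (≤-trans h (≤-reflexive (split e t)))
    where
    split : ∀ e t → (3 + e) * t ≡ 2 * t + (1 + e) * t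
    split = solve-∀

  Δk≤td+k : ∀ t k → k ≤ (1 + e) * t → Δ * k ≤ t * d + k
  Δk≤td+k t k k≤ = begin
    Δ * k                        ≡⟨ peel e k ⟩
    (2 + e) * k + k              ≤⟨ +-monoˡ-≤ k (*-monoʳ-≤ (2 + e) k≤) ⟩
    (2 + e) * ((1 + e) * t) + k  ≡⟨ cong (_+ k) (reassoc e t) ⟩
    t * d + k                    ∎
    where
    open ≤-Reasoning
    peel : ∀ e k → (3 + e) * k ≡ (2 + e) * k + k
    peel = solve-∀
    reassoc : ∀ e t → (2 + e) * ((1 + e) * t) ≡ t * ((1 + e) * (2 + e))
    reassoc = solve-∀

  neighbourhood≤ : ∀ t k x y z → x + y + z ≤ Δ * k → k ≤ x → x ≤ (1 + e) * t →
                   2 * x + y + 2 * z ≤ 2 * (t * d + k)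
  neighbourhood≤ t k x y z x+y+z≤ k≤x x≤ = begin
    2 * x + y + 2 * z      ≤⟨ m≤m+n _ y ⟩
    2 * x + y + 2 * z + y  ≡⟨ regroup x y z ⟩
    2 * (x + y + z)        ≤⟨ *-monoʳ-≤ 2 (≤-trans x+y+z≤ (Δk≤td+k t k (≤-trans k≤x x≤))) ⟩
    2 * (t * d + k)        ∎
    where
    open ≤-Reasoning
    regroup : ∀ x y z → 2 * x + y + 2 * z + y ≡ 2 * (x + y + z)
    regroup = solve-∀

  neighbourhood< : ∀ t k x y → 1 ≤ t → x + y ≤ Δ * k → k ≤ x → x ≤ (1 + e) * t →
                   2 * x + y + 2 ≤ 2 * (t * d + k)
  neighbourhood< t k x y 1≤t x+y≤ k≤x x≤ = begin
    2 * x + y + 2                                      ≡⟨ regroup x y ⟩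
    x + (x + y) + 2                                    ≤⟨ +-monoˡ-≤ 2 (+-monoʳ-≤ x x+y≤) ⟩
    x + Δ * k + 2                                      ≡⟨ peel e x k ⟩
    x + (1 + e) * k + 2 * k + 2                        ≤⟨ +-monoˡ-≤ 2 (+-monoˡ-≤ (2 * k) x+[1+e]k≤) ⟩
    (1 + e) * t + (1 + e) * ((1 + e) * t) + 2 * k + 2  ≡⟨ cong (λ a → a + 2 * k + 2) (factor e t) ⟩
    t * d + 2 * k + 2                                  ≤⟨ +-monoʳ-≤ (t * d + 2 * k) 2≤td ⟩
    t * d + 2 * k + t * d                              ≡⟨ double (t * d) k ⟩
    2 * (t * d + k)                                    ∎
    where
    open ≤-Reasoning
    x+[1+e]k≤ : x + (1 + e) * k ≤ (1 + e) * t + (1 + e) * ((1 + e) * t)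
    x+[1+e]k≤ = +-mono-≤ x≤ (*-monoʳ-≤ (1 + e) (≤-trans k≤x x≤))
    2≤td : 2 ≤ t * d
    2≤td = ≤-trans 2≤d (≤-trans (≤-reflexive (sym (*-identityˡ d))) (*-monoˡ-≤ d 1≤t))
    regroup : ∀ x y → 2 * x + y + 2 ≡ x + (x + y) + 2
    regroup = solve-∀
    peel : ∀ e x k → x + (3 + e) * k + 2 ≡ x + (1 + e) * k + 2 * k + 2
    peel = solve-∀
    factor : ∀ e t → (1 + e) * t + (1 + e) * ((1 + e) * t) ≡ t * ((1 + e) * (2 + e))
    factor = solve-∀
    double : ∀ a k → a + 2 * k + a ≡ 2 * (a + k)
    double = solve-∀

module Bound {n : ℕ} (G : Graph n) (e : ℕ) (maxDegree≤ : ∀ v → Arcs.degW G (λ _ → 1) v ≤ 3 + e) where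
  open Arcs G
  open InducedCycle G
  open StepArithmetic e

  arcs≤ : ∀ X Y → arcs (χ X) (χ Y) ≤ Δ * ∣ X ∣
  arcs≤ X Y = begin
    ∑ (λ v → χ X v * degW (χ Y) v)  ≤⟨ ∑-mono-≤ (λ v → *-monoʳ-≤ (χ X v) (degree≤ v)) ⟩
    ∑ (λ v → χ X v * Δ)       ≡⟨ *-distribʳ-sum {n} Δ (χ X) ⟨
    ∣ X ∣ * Δ                  ≡⟨ *-comm ∣ X ∣ Δ ⟩
    Δ * ∣ X ∣                  ∎
    where
    open ≤-Reasoning
    degree≤ : ∀ v → degW (χ Y) v ≤ Δ
    degree≤ v = ≤-trans (degW-mono (λ u → 𝟙≤1 (Y u)) v) (maxDegree≤ v)

  -- m(G[S]) + 1 ≤ |U| d + |S|, doubled since degSum S = 2 m(G[S]).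
  Bounded : VSet n → VSet n → Set
  Bounded S U = U ⊆ S × TwoRegular U × degSum S + 2 ≤ 2 * (∣ U ∣ * d + ∣ S ∣)

  Bounded-∅ : ∀ S → ¬ ManyEdges S → Bounded S ∅
  Bounded-∅ S fewEdges = (λ _ ()) , (λ _ ()) , (begin
    degSum S + 2                ≡⟨ +-suc (degSum S) 1 ⟩
    suc (degSum S + 1)          ≤⟨ ≰⇒> fewEdges ⟩
    2 * ∣ S ∣                    ≡⟨ cong (λ a → 2 * (a * d + ∣ S ∣)) (∣∅∣ {n}) ⟨
    2 * (∣ ∅ {n} ∣ * d + ∣ S ∣)  ∎)
    where open ≤-Reasoning

  module Extend (S T : VSet n) (T⊆S : T ⊆ S) (twoRegular : TwoRegular T) (1≤t : 1 ≤ ∣ T ∣) where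
    open Split G S T T⊆S public

    t k r x y z w : ℕ
    t = ∣ T ∣
    k = ∣ N ∣
    r = ∣ R ∣
    x = arcs (χ T) (χ N)
    y = degSum N
    z = arcs (χ N) (χ R)
    w = degSum R

    degSum-S : degSum S ≡ 2 * t + 2 * x + y + 2 * z + w
    degSum-S = trans degSum-split (cong (λ a → a + 2 * x + y + 2 * z + w) (degSum-TwoRegular T twoRegular))

    x≤ : x ≤ (1 + e) * t
    x≤ = leaving≤ t x (subst (_≤ Δ * t) arcs-T-S (arcs≤ T S))
      where
      arcs-T-S : arcs (χ T) (χ S) ≡ 2 * t + x
      arcs-T-S = begin
        arcs (χ T) (χ S)                 ≡⟨ arcs-splitʳ (χ T) ⟩
        degSum T + x + arcs (χ T) (χ R)  ≡⟨ cong₂ (λ a b → a + x + b) (degSum-TwoRegular T twoRegular) arcs-T-R ⟩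
        2 * t + x + 0                    ≡⟨ +-identityʳ _ ⟩
        2 * t + x                        ∎
        where open ≡-Reasoning

    x+y+z≤ : x + y + z ≤ Δ * k
    x+y+z≤ = subst (λ a → a + y + z ≤ Δ * k) (arcs-sym (χ N) (χ T))
                   (subst (_≤ Δ * k) (arcs-splitʳ (χ N)) (arcs≤ N S))

    k≤x : k ≤ x
    k≤x = subst (k ≤_) (arcs-sym (χ N) (χ T)) ∣N∣≤arcs-N-T

    whenREmpty : r ≡ 0 → Bounded S T
    whenREmpty r≡0 = T⊆S , twoRegular , (begin
      degSum S + 2                       ≡⟨ cong (_+ 2) degSum-S ⟩
      2 * t + 2 * x + y + 2 * z + w + 2  ≡⟨ cong₂ (λ a b → 2 * t + 2 * x + y + 2 * a + b + 2) z≡0 w≡0 ⟩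
      2 * t + 2 * x + y + 0 + 0 + 2      ≡⟨ regroup t x y ⟩
      2 * t + (2 * x + y + 2)            ≤⟨ +-monoʳ-≤ (2 * t) (neighbourhood< t k x y 1≤t x+y≤ k≤x x≤) ⟩
      2 * t + 2 * (t * d + k)            ≡⟨ collect t k d ⟩
      2 * (t * d + (t + k + 0))          ≡⟨ cong (λ a → 2 * (t * d + (t + k + a))) r≡0 ⟨
      2 * (t * d + (t + k + r))          ≡⟨ cong (λ a → 2 * (t * d + a)) ∣S∣-split ⟨
      2 * (t * d + ∣ S ∣)                ∎)
      where
      open ≤-Reasoning
      R≗0 : ∀ v → χ R v ≡ 0
      R≗0 = ∑≡0⇒≡0 (χ R) r≡0
      z≡0 : z ≡ 0
      z≡0 = trans (arcs-sym (χ N) (χ R)) (arcs-zeroˡ (χ N) R≗0)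
      w≡0 : w ≡ 0
      w≡0 = arcs-zeroˡ (χ R) R≗0
      x+y≤ : x + y ≤ Δ * k
      x+y≤ = ≤-trans (m≤m+n (x + y) z) x+y+z≤
      regroup : ∀ t x y → 2 * t + 2 * x + y + 0 + 0 + 2 ≡ 2 * t + (2 * x + y + 2)
      regroup = solve-∀
      collect : ∀ t k d → 2 * t + 2 * (t * d + k) ≡ 2 * (t * d + (t + k + 0))
      collect = solve-∀

    whenRNonempty : ∀ T′ → Bounded R T′ → Bounded S (T ∪ T′)
    whenRNonempty T′ (T′⊆R , twoRegular′ , bound′) = ∪⊆S , ∪-twoRegular , (begin
      degSum S + 2                                ≡⟨ cong (_+ 2) degSum-S ⟩
      2 * t + 2 * x + y + 2 * z + w + 2           ≡⟨ regroup t x y z w ⟩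
      2 * t + (2 * x + y + 2 * z) + (w + 2)       ≤⟨ +-mono-≤ (+-monoʳ-≤ (2 * t) neighbourhood) bound′ ⟩
      2 * t + 2 * (t * d + k) + 2 * (t′ * d + r)  ≡⟨ collect t t′ k r d ⟩
      2 * ((t + t′) * d + (t + k + r))            ≡⟨ cong₂ (λ a b → 2 * (a * d + b)) ∣∪∣ ∣S∣-split ⟨
      2 * (∣ T ∪ T′ ∣ * d + ∣ S ∣)                 ∎)
      where
      open ≤-Reasoning
      t′ = ∣ T′ ∣
      neighbourhood : 2 * x + y + 2 * z ≤ 2 * (t * d + k)
      neighbourhood = neighbourhood≤ t k x y z x+y+z≤ k≤x x≤
      disjoint : ∀ v → T v ≡ true → T′ v ≡ false
      disjoint v Tv with T′ v in T′v
      ... | true  = contradiction (trans (sym Tv) (R⇒∉T v (T′⊆R v T′v))) λ ()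
      ... | false = refl
      ∪⊆S : (T ∪ T′) ⊆ S
      ∪⊆S v T∪T′v with T v in Tv
      ... | true  = T⊆S v Tv
      ... | false = R⊆S v (T′⊆R v T∪T′v)
      ∪-twoRegular : TwoRegular (T ∪ T′)
      ∪-twoRegular = TwoRegular-∪ T T′ twoRegular twoRegular′
        (n≤0⇒n≡0 (subst (arcs (χ T) (χ T′) ≤_) arcs-T-R (arcs-monoʳ (χ T) (χ-mono T′⊆R))))
      ∣∪∣ : ∣ T ∪ T′ ∣ ≡ t + t′
      ∣∪∣ = trans (sum-cong-≗ (χ-∪ T T′ disjoint)) (∑-distrib-+ {n} (χ T) (χ T′))
      regroup : ∀ t x y z w → 2 * t + 2 * x + y + 2 * z + w + 2 ≡ 2 * t + (2 * x + y + 2 * z) + (w + 2)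
      regroup = solve-∀
      collect : ∀ t t′ k r d → 2 * t + 2 * (t * d + k) + 2 * (t′ * d + r) ≡ 2 * ((t + t′) * d + (t + k + r))
      collect = solve-∀

  twoRegular-bound : ∀ S → 1 ≤ ∣ S ∣ → ∃[ U ] Bounded S U
  twoRegular-bound S = go ∣ S ∣ S ≤-refl
    where
    go : ∀ fuel S → ∣ S ∣ ≤ fuel → 1 ≤ ∣ S ∣ → ∃[ U ] Bounded S U
    go zero S s≤0 1≤s = contradiction (≤-trans 1≤s s≤0) λ ()
    go (suc fuel) S s≤ 1≤s with 2 * ∣ S ∣ ≤? degSum S + 1
    ... | no fewEdges = ∅ , Bounded-∅ S fewEdges
    ... | yes manyEdges with ManyEdges⇒TwoRegular⊆ S 1≤s manyEdges
    ...   | T , T⊆S , twoRegular , 1≤t = recurseOnR ∣ R ∣ refl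
      where
      open Extend S T T⊆S twoRegular 1≤t
      recurseOnR : ∀ m → ∣ R ∣ ≡ m → ∃[ U ] Bounded S U
      recurseOnR zero    r≡0 = T , whenREmpty r≡0
      recurseOnR (suc m) r≡1+m with go fuel R r≤fuel (subst (1 ≤_) (sym r≡1+m) (s≤s z≤n))
        where
        r≤fuel : ∣ R ∣ ≤ fuel
        r≤fuel = ≤-pred (begin
          1 + r          ≤⟨ +-monoˡ-≤ r 1≤t ⟩
          t + r          ≤⟨ +-monoˡ-≤ r (m≤m+n t k) ⟩
          t + k + r      ≡⟨ ∣S∣-split ⟨
          ∣ S ∣          ≤⟨ s≤ ⟩
          suc fuel       ∎)
          where open ≤-Reasoning
      ... | T′ , bounded = T ∪ T′ , whenRNonempty T′ bounded

count-tabulate : ∀ {n} {A : Set} (p : A → Bool) (g : Fin n → A) → count p (tabulate g) ≡ ∑ (λ i → 𝟙 (p (g i)))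
count-tabulate {zero}  p g = refl
count-tabulate {suc n} p g with p (g zero)
... | true  = cong suc (count-tabulate p (g ∘ suc))
... | false = count-tabulate p (g ∘ suc)

sum-map-tabulate : ∀ {n} {A : Set} (f : A → ℕ) (g : Fin n → A) → sum (map f (tabulate g)) ≡ ∑ (f ∘ g)
sum-map-tabulate {zero}  f g = refl
sum-map-tabulate {suc n} f g = cong (f (g zero) +_) (sum-map-tabulate f (g ∘ suc))

≤-foldr-⊔ : ∀ {x : ℕ} {xs} → x ∈ xs → x ≤ foldr _⊔_ 0 xs
≤-foldr-⊔ {xs = y ∷ ys} (here refl)  = m≤m⊔n y _
≤-foldr-⊔ {xs = y ∷ ys} (there x∈ys) = ≤-trans (≤-foldr-⊔ x∈ys) (m≤n⊔m y _)

allᵇ-true : ∀ {A : Set} (p : A → Bool) xs → (∀ x → p x ≡ true) → allᵇ p xs ≡ true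
allᵇ-true p []       _    = refl
allᵇ-true p (x ∷ xs) p≡true rewrite p≡true x = allᵇ-true p xs p≡true

allVSets-complete : ∀ {n} (S : VSet n) → ∃[ S′ ] S′ ∈ allVSets n × (∀ v → S′ v ≡ S v)
allVSets-complete {zero}  S = _ , here refl , λ ()
allVSets-complete {suc n} S with allVSets-complete (S ∘ suc) | S zero in S0
... | S′ , S′∈ , S′≗ | false = _ , ∈-concatMap⁺ _ (lose S′∈ (here refl))         , λ { zero → sym S0 ; (suc v) → S′≗ v }
... | S′ , S′∈ , S′≗ | true  = _ , ∈-concatMap⁺ _ (lose S′∈ (there (here refl))) , λ { zero → sym S0 ; (suc v) → S′≗ v }

module Translation {n : ℕ} (G : Graph n) where
  open Arcs G

  V : VSet n
  V _ = true

  ∣V∣ : ∣ V ∣ ≡ n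
  ∣V∣ = ∑-ones n

  lt : Fin n → Fin n → Bool
  lt i j = toℕ i <ᵇ toℕ j

  lt⇒< : ∀ i j → lt i j ≡ true → toℕ i < toℕ j
  lt⇒< i j i<j = <ᵇ⇒< (toℕ i) (toℕ j) (subst T (sym i<j) tt)

  card≡∣∣ : ∀ S → card S ≡ ∣ S ∣
  card≡∣∣ S = count-tabulate {n} S id

  degIn≡degW : ∀ S v → degIn G S v ≡ degW (χ S) v
  degIn≡degW S v = trans (count-tabulate (λ u → S u ∧ adj G v u) id) (sum-cong-≗ (λ u → 𝟙-∧ (S u) (adj G v u)))

  deg≡degW : ∀ v → deg G v ≡ degW (χ V) v
  deg≡degW v = trans (count-tabulate (adj G v) id) (sum-cong-≗ (λ u → sym (+-identityʳ (A v u))))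

  deg≤maxDeg : ∀ v → deg G v ≤ maxDeg G
  deg≤maxDeg v = ≤-foldr-⊔ (∈-map⁺ (deg G) (∈-allFin v))

  TwoRegular⇒is2Regᵇ : ∀ S → TwoRegular S → is2Regᵇ G S ≡ true
  TwoRegular⇒is2Regᵇ S twoRegular = allᵇ-true _ (allFin n) degreeTwo
    where
    degreeTwo : ∀ v → (if S v then degIn G S v ≡ᵇ 2 else true) ≡ true
    degreeTwo v with S v in Sv
    ... | false = refl
    ... | true rewrite degIn≡degW S v | twoRegular v Sv = refl

  ∣∣≤cind : ∀ S → TwoRegular S → ∣ S ∣ ≤ cind G
  ∣∣≤cind S twoRegular with allVSets-complete S
  ... | S′ , S′∈ , S′≗S = begin
    ∣ S ∣    ≡⟨ sum-cong-≗ {n} (cong 𝟙 ∘ S′≗S) ⟨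
    ∣ S′ ∣   ≡⟨ card≡∣∣ S′ ⟨
    card S′  ≤⟨ ≤-foldr-⊔ (∈-map⁺ card (∈-filter⁺ (T? ∘ is2Regᵇ G) S′∈ S′-is2Reg)) ⟩
    cind G   ∎
    where
    open ≤-Reasoning
    twoRegular′ : TwoRegular S′
    twoRegular′ v S′v = trans (degW-cong (cong 𝟙 ∘ S′≗S) v) (twoRegular v (trans (sym (S′≗S v)) S′v))
    S′-is2Reg : T (is2Regᵇ G S′)
    S′-is2Reg = subst T (sym (TwoRegular⇒is2Regᵇ S′ twoRegular′)) tt

  edgeCount : size G ≡ ∑ (λ i → ∑ (λ j → 𝟙 (lt i j ∧ adj G i j)))
  edgeCount = trans (sum-map-tabulate {n} (λ i → count (λ j → lt i j ∧ adj G i j) (allFin n)) id)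
                    (sum-cong-≗ {n} (λ i → count-tabulate {n} (λ j → lt i j ∧ adj G i j) id))

  oriented≤A : ∀ i j → 𝟙 (lt i j ∧ adj G i j) + 𝟙 (lt j i ∧ adj G i j) ≤ A i j
  oriented≤A i j with lt i j in i<j | lt j i in j<i | adj G i j
  ... | true  | true  | true  = contradiction (lt⇒< j i j<i) (<⇒≯ (lt⇒< i j i<j))
  ... | true  | true  | false = z≤n
  ... | true  | false | _     = ≤-reflexive (+-identityʳ _)
  ... | false | true  | _     = ≤-refl
  ... | false | false | _     = z≤n

  2*size≤degSum : 2 * size G ≤ degSum V
  2*size≤degSum = begin
    2 * size G                                    ≡⟨ cong (2 *_) edgeCount ⟩
    P + (P + 0)                                   ≡⟨ cong (λ q → P + (q + 0)) P≡Q ⟩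
    P + (Q + 0)                                   ≡⟨ cong (P +_) (+-identityʳ Q) ⟩
    P + Q                                         ≡⟨ ∑-distrib-+ {n} _ _ ⟨
    ∑ (λ i → ∑ (λ j → p i j) + ∑ (λ j → q i j))   ≡⟨ sum-cong-≗ (λ i → ∑-distrib-+ {n} (p i) (q i)) ⟨
    ∑ (λ i → ∑ (λ j → p i j + q i j))             ≤⟨ ∑-mono-≤ (λ i → ∑-mono-≤ (oriented≤A i)) ⟩
    ∑ (λ i → ∑ (λ j → A i j))                     ≡⟨ sum-cong-≗ (λ i → trans (sum-cong-≗ (padding ∘ A i)) (padding _)) ⟩
    degSum V                                      ∎
    where
    open ≤-Reasoning
    p q : Fin n → Fin n → ℕ
    p i j = 𝟙 (lt i j ∧ adj G i j)
    q i j = 𝟙 (lt j i ∧ adj G i j)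
    P Q : ℕ
    P = ∑ (λ i → ∑ (p i))
    Q = ∑ (λ i → ∑ (q i))
    padding : ∀ a → a ≡ a + 0
    padding a = sym (+-identityʳ a)
    P≡Q : P ≡ Q
    P≡Q = trans (∑-comm {n} {n} p) (sum-cong-≗ (λ j → sum-cong-≗ (λ i → cong (λ b → 𝟙 (lt i j ∧ b)) (symmetric G i j))))

module _ {n : ℕ} (G : Graph n) (e : ℕ) (deg≤ : ∀ v → deg G v ≤ 3 + e) where
  open Arcs G
  open Translation G
  open Bound G e (λ v → subst (_≤ 3 + e) (deg≡degW v) (deg≤ v))
  open StepArithmetic e using (d)

  cind-bound : 1 ≤ n → size G + 1 ≤ cind G * ((1 + e) * (2 + e)) + n
  cind-bound 1≤n with twoRegular-bound V (subst (1 ≤_) (sym ∣V∣) 1≤n)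
  ... | U , _ , twoRegular , bound = *-cancelˡ-≤ 2 (begin
    2 * (size G + 1)        ≡⟨ *-distribˡ-+ 2 (size G) 1 ⟩
    2 * size G + 2          ≤⟨ +-monoˡ-≤ 2 2*size≤degSum ⟩
    degSum V + 2            ≤⟨ bound ⟩
    2 * (∣ U ∣ * d + ∣ V ∣)  ≤⟨ *-monoʳ-≤ 2 (+-mono-≤ (*-monoˡ-≤ d (∣∣≤cind U twoRegular)) (≤-reflexive ∣V∣)) ⟩
    2 * (cind G * d + n)    ∎)
    where open ≤-Reasoning

mainTheorem2 : ∀ {n} (G : Graph n) → 3 ≤ maxDeg G →
    size G + 1 ≤ cind G * ((maxDeg G ∸ 2) * (maxDeg G ∸ 1)) + order G
mainTheorem2 {zero}  G ()
mainTheorem2 {suc n} G 3≤Δ = bound (maxDeg G) 3≤Δ (Translation.deg≤maxDeg G)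
  where
  bound : ∀ Δ → 3 ≤ Δ → (∀ v → deg G v ≤ Δ) → size G + 1 ≤ cind G * ((Δ ∸ 2) * (Δ ∸ 1)) + suc n
  bound (suc (suc (suc e))) (s≤s (s≤s (s≤s _))) deg≤Δ = cind-bound G e deg≤Δ (s≤s z≤n)
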